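{- Let $G=(V,E)$ be a directed acyclic graph with vertices $s,t\in V$. Let $\gamma\subseteq E$ be the edge set of a directed $s$-$t$ path in $G$, and let $e_1,\dots,e_k$ be distinct edges of $E\setminus\gamma$ ($k\ge0$). Put $a=\gamma\cup\{e_1,\dots,e_k\}$. For $i=1,\dots,k$ define the multiplicity $M_{e_i}=\frac12$ if both endpoints of $e_i$ are endpoints of some edge in $\gamma\cup\{e_1,\dots,e_{i-1}\}$, and $M_{e_i}=1$ otherwise. Let $\mathcal P(a)$ denote the set of directed $s$-$t$ paths in $G$ all of whose edges lie in $a$. Then $$\frac{1}{|\mathcal P(a)|}\geq\prod_{i=1}^k M_{e_i}.$$ -}

module Defs where

open import Data.Nat using (ℕ; zero; suc)
open import Data.Fin using (Fin; _≟_)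
open import Data.Product using (_×_; _,_; proj₁; proj₂)
open import Data.Sum using (_⊎_)
open import Data.Empty using (⊥)
open import Data.List using (List; []; _∷_; _++_; [_])
open import Data.List.Relation.Unary.Any using (Any; any?)
open import Data.List.Membership.Propositional using (_∈_)
open import Data.Integer using (+_)
open import Data.Rational using (ℚ; _/_; _*_; ½; 0ℚ; 1ℚ)
open import Relation.Nullary using (Dec; yes; no; _×-dec_; _⊎-dec_)
open import Relation.Binary.PropositionalEquality using (_≡_)

Edge : ℕ → Set
Edge n = Fin n × Fin n

Graph : ℕ → Set₁
Graph n = Fin n → Fin n → Set

data PathFrom {n : ℕ} (R : Graph n) : Fin n → Fin n → List (Fin n) → Set where
  here : ∀ {v} → PathFrom R v v (v ∷ [])
  step : ∀ {u w t vs} → R u w → PathFrom R w t vs → PathFrom R u t (u ∷ vs)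

Acyclic : ∀ {n} → Graph n → Set
Acyclic {n} E = ∀ (u w : Fin n) (vs : List (Fin n)) → E u w → PathFrom E w u vs → ⊥

edges : ∀ {n} → List (Fin n) → List (Edge n)
edges [] = []
edges (u ∷ []) = []
edges (u ∷ w ∷ vs) = (u , w) ∷ edges (w ∷ vs)

Touches : ∀ {n} → List (Edge n) → Fin n → Set
Touches es v = Any (λ e → proj₁ e ≡ v ⊎ proj₂ e ≡ v) es

touches? : ∀ {n} (es : List (Edge n)) (v : Fin n) → Dec (Touches es v)
touches? es v = any? (λ e → (proj₁ e ≟ v) ⊎-dec (proj₂ e ≟ v)) es

mult : ∀ {n} → List (Edge n) → Edge n → ℚ
mult prev (u , w) with touches? prev u ×-dec touches? prev w
... | yes _ = ½
... | no _ = 1ℚ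

prodMult : ∀ {n} → List (Edge n) → List (Edge n) → ℚ
prodMult prev [] = 1ℚ
prodMult prev (e ∷ es) = mult prev e * prodMult (prev ++ [ e ]) es

-- 1/m as a rational (the m = 0 case is never used, since |P(a)| ≥ 1).
recipℕ : ℕ → ℚ
recipℕ zero = 0ℚ
recipℕ (suc m) = + 1 / suc m

InA : ∀ {n} → List (Edge n) → List (Edge n) → Graph n
InA γ es u w = (u , w) ∈ γ ⊎ (u , w) ∈ es

-- Let a = γ ∪ {e₁,…,e_k}, adding the edges in this order, and call eᵢ a
-- *half edge* if both its endpoints already touch earlier edges (M_{eᵢ} = ½).
-- With h half edges the right-hand side is ∏ M_{eᵢ} = 1/2^h, so it suffices
-- to show that an s-t path in a is determined by which half edges it uses:
-- then |P(a)| ≤ 2^h.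
--
-- "Walks in P are determined by their use of H" (`Determined P H`) is
-- maintained while edges are added one at a time to an acyclic edge list P:
--  * adding an edge e with an untouched endpoint keeps H: a walk using e would
--    have to start or end at that untouched endpoint (`extend-fresh`);
--  * adding any edge e while also adding it to H is always safe: two walks
--    through e agree before and after e (`extend-half`).
-- Acyclicity is what makes cutting walks at e work.  Starting from the empty
-- graph, the edges of γ themselves all have a fresh head (`halfEdges-along-path`),
-- and then e₁,…,e_k contribute exactly the half edges.
module Submission where

open import Defs
open import Data.Nat using (ℕ)
open import Data.Fin using (Fin)
open import Data.Product using (_,_; proj₁; proj₂)
open import Data.List using (List; length)
open import Data.List.Relation.Unary.All using (All)
open import Data.List.Relation.Unary.Unique.Propositional using (Unique)
open import Data.List.Membership.Propositional using (_∈_; _∉_)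
open import Data.Rational using (_≤_)

open import Function using (_∘_)
open import Data.Nat as ℕ using (zero; suc; _^_; z≤n; s≤s)
import Data.Nat.Properties as ℕP
import Data.Fin as Fin
open import Data.Bool using (Bool; true; false)
import Data.Bool as Bool
open import Data.Vec using (Vec; []; _∷_; head; tail)
open import Data.Product using (∃-syntax)
open import Data.Product.Properties using (≡-dec)
open import Data.Sum using (_⊎_; inj₁; inj₂)
import Data.Sum as Sum
open import Data.Empty using (⊥; ⊥-elim)
open import Data.List using ([]; _∷_; _++_; [_]; filter)
open import Data.List.Properties using (++-assoc; ++-identityʳ)
open import Data.List.Relation.Unary.Any using (here; there)
import Data.List.Relation.Unary.Any as Any
import Data.List.Relation.Unary.Any.Properties as Any
import Data.List.Relation.Unary.All as All
import Data.List.Relation.Unary.Unique.Propositional.Properties as Unique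
open import Data.List.Relation.Unary.AllPairs using (_∷_)
open import Data.List.Membership.Propositional.Properties
  using (∈-++⁺ˡ; ∈-++⁺ʳ; ∈-++⁻; ∈-filter⁻; ∈-length)
import Data.List.Membership.DecPropositional as DecMembership
open import Relation.Nullary using (Dec; yes; no; ¬_; does; _×-dec_)
open import Relation.Binary.PropositionalEquality hiding ([_])
open import Data.Integer as ℤ using (+_; +≤+)
import Data.Integer.Properties as ℤP
open import Data.Rational using (mkℚ; _*_; ½; *≤*)
import Data.Rational.Properties as ℚP
open import Data.Nat.Coprimality using (1-coprimeTo)

InjectiveOn : {A B : Set} → (A → B) → List A → Set
InjectiveOn f xs = ∀ {x y} → x ∈ xs → y ∈ xs → f x ≡ f y → x ≡ y

length-split-Bool : {A : Set} (g : A → Bool) (xs : List A) →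
  length xs ≡ length (filter (λ x → g x Bool.≟ true) xs)
              ℕ.+ length (filter (λ x → g x Bool.≟ false) xs)
length-split-Bool g [] = refl
length-split-Bool g (x ∷ xs) with g x
... | true  = cong suc (length-split-Bool g xs)
... | false = trans (cong suc (length-split-Bool g xs)) (sym (ℕP.+-suc _ _))

vec₀-unique : {A : Set} (v w : Vec A 0) → v ≡ w
vec₀-unique [] [] = refl

head-tail-injective : {A : Set} {m : ℕ} (v w : Vec A (suc m)) →
  head v ≡ head w → tail v ≡ tail w → v ≡ w
head-tail-injective (x ∷ v) (.x ∷ .v) refl refl = refl

-- Induction on m: split the list by the first bit; on each class the
-- remaining m bits are still injective.
injective-into-bits : {A : Set} (m : ℕ) (f : A → Vec Bool m) (xs : List A) →
  Unique xs → InjectiveOn f xs → length xs ℕ.≤ 2 ^ m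
injective-into-bits zero f [] _ _ = z≤n
injective-into-bits zero f (_ ∷ []) _ _ = s≤s z≤n
injective-into-bits zero f (x ∷ y ∷ _) ((x≢y All.∷ _) ∷ _) inj =
  ⊥-elim (x≢y (inj (here refl) (there (here refl)) (vec₀-unique (f x) (f y))))
injective-into-bits {A} (suc m) f xs unique inj = begin
  length xs
    ≡⟨ length-split-Bool (head ∘ f) xs ⟩
  length (class true) ℕ.+ length (class false)
    ≤⟨ ℕP.+-mono-≤ (class-bound true) (class-bound false) ⟩
  2 ^ m ℕ.+ 2 ^ m
    ≡⟨ cong (2 ^ m ℕ.+_) (sym (ℕP.+-identityʳ (2 ^ m))) ⟩
  2 ^ suc m ∎
  where
  open ℕP.≤-Reasoning
  class : Bool → List A
  class b = filter (λ x → head (f x) Bool.≟ b) xs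

  class-bound : ∀ b → length (class b) ℕ.≤ 2 ^ m
  class-bound b = injective-into-bits m (tail ∘ f) (class b) (Unique.filter⁺ _ unique) tail-inj
    where
    tail-inj : InjectiveOn (tail ∘ f) (class b)
    tail-inj x∈ y∈ same-tail with ∈-filter⁻ _ x∈ | ∈-filter⁻ _ y∈
    ... | x∈xs , hx | y∈xs , hy =
      inj x∈xs y∈xs (head-tail-injective (f _) (f _) (trans hx (sym hy)) same-tail)

recipℕ-suc : ∀ d → recipℕ (suc d) ≡ mkℚ (+ 1) d (1-coprimeTo (suc d))
recipℕ-suc d = ℚP.normalize-coprime (1-coprimeTo (suc d))

-- Halving a unit fraction doubles its denominator; for m = d+1 the product
-- ½ * 1/(d+1) normalises to 1/(2d+2) by computation.
½*recipℕ : ∀ m → ½ * recipℕ m ≡ recipℕ (2 ℕ.* m)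
½*recipℕ zero    = refl
½*recipℕ (suc d) = cong (½ *_) (recipℕ-suc d)

recipℕ-antimono : ∀ {m m′} → 0 ℕ.< m → m ℕ.≤ m′ → recipℕ m′ ≤ recipℕ m
recipℕ-antimono {suc d} {suc d′} _ m≤m′ rewrite recipℕ-suc d | recipℕ-suc d′ =
  *≤* (subst₂ ℤ._≤_ (sym (ℤP.*-identityˡ _)) (sym (ℤP.*-identityˡ _))
          (+≤+ m≤m′))

halfEdges : ∀ {n} → List (Edge n) → List (Edge n) → List (Edge n)
halfEdges prev [] = []
halfEdges prev ((u , w) ∷ es) with touches? prev u ×-dec touches? prev w
... | yes _ = (u , w) ∷ halfEdges (prev ++ [ (u , w) ]) es
... | no _  = halfEdges (prev ++ [ (u , w) ]) es

prodMult-halfEdges : ∀ {n} (prev es : List (Edge n)) →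
  prodMult prev es ≡ recipℕ (2 ^ length (halfEdges prev es))
prodMult-halfEdges prev [] = refl
prodMult-halfEdges prev ((u , w) ∷ es) with touches? prev u ×-dec touches? prev w
... | yes _ = trans (cong (½ *_) (prodMult-halfEdges (prev ++ [ (u , w) ]) es))
                  (½*recipℕ (2 ^ length (halfEdges _ es)))
... | no _  = trans (ℚP.*-identityˡ _) (prodMult-halfEdges (prev ++ [ (u , w) ]) es)

module Walks {n : ℕ} where

  private variable
    R R′ : Graph n
    x y u w : Fin n
    vs ws : List (Fin n)
    P H : List (Edge n)
    e : Edge n

  walk-map : (∀ {u w} → R u w → R′ u w) → PathFrom R x y vs → PathFrom R′ x y vs
  walk-map f here       = here
  walk-map f (step r p) = step (f r) (walk-map f p)

  walk-++ : PathFrom R x y vs → PathFrom R y u ws → ∃[ zs ] PathFrom R x u zs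
  walk-++ here       q = _ , q
  walk-++ (step r p) q = _ , step r (proj₂ (walk-++ p q))

  Acyclic-mono : (∀ {u w} → R u w → R′ u w) → Acyclic R′ → Acyclic R
  Acyclic-mono f acyc u w vs r p = acyc u w vs (f r) (walk-map f p)

  walk-head : PathFrom R x y vs → ∃[ zs ] vs ≡ x ∷ zs
  walk-head here       = _ , refl
  walk-head (step _ _) = _ , refl

  record Cut (R : Graph n) (x y : Fin n) (vs : List (Fin n)) (u w : Fin n) : Set where
    constructor cut
    field
      pre suf   : List (Fin n)
      walk-pre  : PathFrom R x u pre
      walk-suf  : PathFrom R w y suf
      cut-edge  : R u w
      vertices  : vs ≡ pre ++ suf
      edge-list : edges vs ≡ edges pre ++ (u , w) ∷ edges suf
  open Cut

  cut-at : PathFrom R x y vs → (u , w) ∈ edges vs → Cut R x y vs u w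
  cut-at (step r p) m with walk-head p
  ... | _ , refl with m
  ...   | here refl = cut _ _ here p r refl refl
  ...   | there m′ with cut-at p m′
  ...     | cut pre suf p₁ p₂ r′ eq el with walk-head p₁
  ...       | _ , refl rewrite eq = cut _ suf (step r p₁) p₂ r′ refl (cong (_ ∷_) el)

  pre⊆ : (C : Cut R x y vs u w) → ∀ {h} → h ∈ edges (pre C) → h ∈ edges vs
  pre⊆ C = subst (_ ∈_) (sym (edge-list C)) ∘ ∈-++⁺ˡ

  suf⊆ : (C : Cut R x y vs u w) → ∀ {h} → h ∈ edges (suf C) → h ∈ edges vs
  suf⊆ C = subst (_ ∈_) (sym (edge-list C)) ∘ ∈-++⁺ʳ (edges (pre C)) ∘ there

  locate : (C : Cut R x y vs u w) → ∀ {h} → h ∈ edges vs →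
    h ∈ edges (pre C) ⊎ h ∈ (u , w) ∷ edges (suf C)
  locate C = ∈-++⁻ (edges (pre C)) ∘ subst (_ ∈_) (edge-list C)

  walk-edge : PathFrom R x y vs → (u , w) ∈ edges vs → R u w
  walk-edge p m = cut-edge (cut-at p m)

  walk-in-own-edges : PathFrom R x y vs → PathFrom (λ a b → (a , b) ∈ edges vs) x y vs
  walk-in-own-edges here = here
  walk-in-own-edges (step r p) with walk-head p
  ... | _ , refl = step (here refl) (walk-map there (walk-in-own-edges p))

  module _ (acyc : Acyclic R) where

    edge∉walk-into-tail : R u w → PathFrom R x u vs → (u , w) ∉ edges vs
    edge∉walk-into-tail r p m = acyc _ _ _ r (walk-suf (cut-at p m))

    edge∉walk-from-head : R u w → PathFrom R w y vs → (u , w) ∉ edges vs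
    edge∉walk-from-head r p m = acyc _ _ _ r (walk-pre (cut-at p m))

    -- For an edge u → w, walks into u and walks out of w share no edge:
    -- a shared edge a → b would close the cycle b ⇝ u → w ⇝ a → b.
    into-out-of-disjoint : ∀ {h} → R u w → PathFrom R x u vs → PathFrom R w y ws →
      h ∈ edges vs → h ∈ edges ws → ⊥
    into-out-of-disjoint r p q m₁ m₂ with cut-at p m₁ | cut-at q m₂
    ... | cut _ _ _ b⇝u ab _ _ | cut _ _ w⇝a _ _ _ _ =
          acyc _ _ _ ab (proj₂ (walk-++ b⇝u (step r w⇝a)))

    closed-walk-edgeless : PathFrom R x x vs → (u , w) ∉ edges vs
    closed-walk-edgeless p m with cut-at p m
    ... | cut _ _ x⇝u w⇝x r _ _ = acyc _ _ _ r (proj₂ (walk-++ w⇝x x⇝u))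

  graphOf : List (Edge n) → Graph n
  graphOf P u w = (u , w) ∈ P

  _∈ᴱ?_ : (e : Edge n) (P : List (Edge n)) → Dec (e ∈ P)
  _∈ᴱ?_ = DecMembership._∈?_ (≡-dec Fin._≟_ Fin._≟_)

  old-edge : ∀ {a} → a ∈ P ++ [ e ] → ¬ a ≡ e → a ∈ P
  old-edge {P} m a≢e with ∈-++⁻ P m
  ... | inj₁ m′        = m′
  ... | inj₂ (here eq) = ⊥-elim (a≢e eq)

  avoid-new-edge : PathFrom (graphOf (P ++ [ e ])) x y vs → e ∉ edges vs →
    PathFrom (graphOf P) x y vs
  avoid-new-edge here _ = here
  avoid-new-edge (step r p) e∉ with walk-head p
  ... | _ , refl = step (old-edge r (e∉ ∘ here ∘ sym)) (avoid-new-edge p (e∉ ∘ there))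

  edge-touches-tail : (u , w) ∈ P → Touches P u
  edge-touches-tail = Any.map (λ eq → inj₁ (cong proj₁ (sym eq)))

  edge-touches-head : (u , w) ∈ P → Touches P w
  edge-touches-head = Any.map (λ eq → inj₂ (cong proj₂ (sym eq)))

  walk-from-untouched : PathFrom (graphOf P) x y vs → ¬ Touches P x → x ≡ y
  walk-from-untouched here       _  = refl
  walk-from-untouched (step r _) nt = ⊥-elim (nt (edge-touches-tail r))

  walk-to-untouched : PathFrom (graphOf P) x y vs → ¬ Touches P y → x ≡ y
  walk-to-untouched here       _  = refl
  walk-to-untouched (step r p) nt with walk-to-untouched p nt
  ... | refl = ⊥-elim (nt (edge-touches-head r))

  SameOn : List (Edge n) → List (Fin n) → List (Fin n) → Set
  SameOn H vs ws = ∀ {h} → h ∈ H → h ∈ edges vs → h ∈ edges ws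

  Determined : List (Edge n) → List (Edge n) → Set
  Determined P H = ∀ {x y vs ws} →
    PathFrom (graphOf P) x y vs → PathFrom (graphOf P) x y ws →
    SameOn H vs ws → SameOn H ws vs → vs ≡ ws

  determined-empty : Determined [] []
  determined-empty here       here      _ _ = refl
  determined-empty (step () _) _        _ _
  determined-empty here       (step () _) _ _

  SameOn-++ˡ : ∀ {H′} → SameOn (H ++ H′) vs ws → SameOn H vs ws
  SameOn-++ˡ same = same ∘ ∈-++⁺ˡ

  module _ (acyc : Acyclic R) where

    -- Two walks cut at the same edge and agreeing on H still agree on H
    -- before the cut and after it, since the parts are edge-disjoint.
    agree-before : (S : Cut R x y vs u w) (T : Cut R x y ws u w) →
      SameOn H vs ws → SameOn H (pre S) (pre T)
    agree-before S T same h∈H h∈pre with locate T (same h∈H (pre⊆ S h∈pre))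
    ... | inj₁ m           = m
    ... | inj₂ (here refl) =
          ⊥-elim (edge∉walk-into-tail acyc (cut-edge S) (walk-pre S) h∈pre)
    ... | inj₂ (there m)   =
          ⊥-elim (into-out-of-disjoint acyc (cut-edge S) (walk-pre S) (walk-suf T) h∈pre m)

    agree-after : (S : Cut R x y vs u w) (T : Cut R x y ws u w) →
      SameOn H vs ws → SameOn H (suf S) (suf T)
    agree-after S T same h∈H h∈suf with locate T (same h∈H (suf⊆ S h∈suf))
    ... | inj₁ m           =
          ⊥-elim (into-out-of-disjoint acyc (cut-edge S) (walk-pre T) (walk-suf S) m h∈suf)
    ... | inj₂ (here refl) =
          ⊥-elim (edge∉walk-from-head acyc (cut-edge S) (walk-suf S) h∈suf)
    ... | inj₂ (there m)   = m

  -- Two walks through the new edge e = (u , w) agreeing on H are equal: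
  -- their parts before and after e avoid e, so the old invariant applies.
  both-use-new-edge : Acyclic (graphOf (P ++ [ (u , w) ])) → Determined P H →
    (p : PathFrom (graphOf (P ++ [ (u , w) ])) x y vs) →
    (q : PathFrom (graphOf (P ++ [ (u , w) ])) x y ws) →
    (u , w) ∈ edges vs → (u , w) ∈ edges ws →
    SameOn H vs ws → SameOn H ws vs → vs ≡ ws
  both-use-new-edge {P = P} {u = u} {w = w} {x = x} {y = y} {vs = vs} {ws = ws}
                    acyc det p q mp mq same₁ same₂ = begin
    vs                ≡⟨ vertices S ⟩
    pre S ++ suf S    ≡⟨ cong₂ _++_ pre-equal suf-equal ⟩
    pre T ++ suf T    ≡⟨ sym (vertices T) ⟩
    ws                ∎
    where
    open ≡-Reasoning
    New : Graph n
    New = graphOf (P ++ [ (u , w) ])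

    S : Cut New x y vs u w
    S = cut-at p mp

    T : Cut New x y ws u w
    T = cut-at q mq

    old-pre : ∀ {zs} (C : Cut New x y zs u w) → PathFrom (graphOf P) x u (pre C)
    old-pre C = avoid-new-edge (walk-pre C) (edge∉walk-into-tail acyc (cut-edge C) (walk-pre C))

    old-suf : ∀ {zs} (C : Cut New x y zs u w) → PathFrom (graphOf P) w y (suf C)
    old-suf C = avoid-new-edge (walk-suf C) (edge∉walk-from-head acyc (cut-edge C) (walk-suf C))

    pre-equal : pre S ≡ pre T
    pre-equal = det (old-pre S) (old-pre T)
                    (agree-before acyc S T same₁) (agree-before acyc T S same₂)

    suf-equal : suf S ≡ suf T
    suf-equal = det (old-suf S) (old-suf T)
                    (agree-after acyc S T same₁) (agree-after acyc T S same₂)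

  -- If the new edge e has an endpoint untouched by P, no old walk can be
  -- rerouted through e: cutting the new walk at e and using that the
  -- untouched endpoint is isolated in P produces a closed walk through e.
  fresh-edge-unmatched : Acyclic (graphOf (P ++ [ (u , w) ])) →
    (¬ Touches P u ⊎ ¬ Touches P w) →
    (p : PathFrom (graphOf (P ++ [ (u , w) ])) x y vs) → (u , w) ∈ edges vs →
    PathFrom (graphOf P) x y ws → ⊥
  fresh-edge-unmatched acyc fresh p m q with cut-at p m
  ... | cut _ _ p₁ p₂ r refl _ with fresh
  ... | inj₁ u-fresh
    with walk-to-untouched (avoid-new-edge p₁ (edge∉walk-into-tail acyc r p₁)) u-fresh
  ...   | refl with walk-from-untouched q u-fresh
  ...     | refl = closed-walk-edgeless acyc p m
  fresh-edge-unmatched acyc fresh p m q | cut _ _ p₁ p₂ r refl _ | inj₂ w-fresh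
    with walk-from-untouched (avoid-new-edge p₂ (edge∉walk-from-head acyc r p₂)) w-fresh
  ... | refl with walk-to-untouched q w-fresh
  ...   | refl = closed-walk-edgeless acyc p m

  -- Adding an edge with an untouched endpoint preserves the invariant with
  -- the same H: walks through the edge cannot be matched by walks avoiding it.
  extend-fresh : Acyclic (graphOf (P ++ [ (u , w) ])) →
    (¬ Touches P u ⊎ ¬ Touches P w) →
    Determined P H → Determined (P ++ [ (u , w) ]) H
  extend-fresh {u = u} {w = w} acyc fresh det {vs = vs} {ws} p q same₁ same₂
    with (u , w) ∈ᴱ? edges vs | (u , w) ∈ᴱ? edges ws
  ... | yes mp | yes mq = both-use-new-edge acyc det p q mp mq same₁ same₂
  ... | no np  | no nq  = det (avoid-new-edge p np) (avoid-new-edge q nq) same₁ same₂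
  ... | yes mp | no nq  = ⊥-elim (fresh-edge-unmatched acyc fresh p mp (avoid-new-edge q nq))
  ... | no np  | yes mq = ⊥-elim (fresh-edge-unmatched acyc fresh q mq (avoid-new-edge p np))

  -- Adding any edge e preserves the invariant once e is also recorded in H:
  -- agreement on H then forces both walks to use e or both to avoid it.
  extend-half : Acyclic (graphOf (P ++ [ e ])) →
    Determined P H → Determined (P ++ [ e ]) (H ++ [ e ])
  extend-half {e = e} {H = H} acyc det {vs = vs} {ws} p q same₁ same₂
    with e ∈ᴱ? edges vs | e ∈ᴱ? edges ws
  ... | yes mp | yes mq =
        both-use-new-edge acyc det p q mp mq (SameOn-++ˡ same₁) (SameOn-++ˡ same₂)
  ... | no np  | no nq  =
        det (avoid-new-edge p np) (avoid-new-edge q nq) (SameOn-++ˡ same₁) (SameOn-++ˡ same₂)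
  ... | yes mp | no nq  = ⊥-elim (nq (same₁ (∈-++⁺ʳ H (here refl)) mp))
  ... | no np  | yes mq = ⊥-elim (np (same₂ (∈-++⁺ʳ H (here refl)) mq))

  acyclic-shift : ∀ P es → Acyclic (graphOf (P ++ e ∷ es)) →
    Acyclic (graphOf ((P ++ [ e ]) ++ es))
  acyclic-shift P es = Acyclic-mono (subst (_ ∈_) (++-assoc P _ es))

  acyclic-prefix : ∀ P es → Acyclic (graphOf (P ++ es)) → Acyclic (graphOf P)
  acyclic-prefix P es = Acyclic-mono ∈-++⁺ˡ

  extend : ∀ P H es → Acyclic (graphOf (P ++ es)) → Determined P H →
    Determined (P ++ es) (H ++ halfEdges P es)
  extend P H [] _ det = subst₂ Determined (sym (++-identityʳ P)) (sym (++-identityʳ H)) det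
  extend P H ((u , w) ∷ es) acyc det with touches? P u ×-dec touches? P w
  ... | yes _ =
        subst₂ Determined (++-assoc P _ es) (++-assoc H _ _)
          (extend (P ++ [ (u , w) ]) (H ++ [ (u , w) ]) es (acyclic-shift P es acyc)
            (extend-half (acyclic-prefix _ es (acyclic-shift P es acyc)) det))
  ... | no not-both =
        subst₂ Determined (++-assoc P _ es) refl
          (extend (P ++ [ (u , w) ]) H es (acyclic-shift P es acyc)
            (extend-fresh (acyclic-prefix _ es (acyclic-shift P es acyc)) fresh det))
    where
    fresh : ¬ Touches P u ⊎ ¬ Touches P w
    fresh with touches? P u
    ... | yes tu = inj₂ (λ tw → not-both (tu , tw))
    ... | no nu  = inj₁ nu

  -- Along a path of an acyclic graph, each edge's head is new, provided
  -- every previously touched vertex reaches the current vertex.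
  halfEdges-along-path : Acyclic R → ∀ P → PathFrom R w y vs →
    (∀ {v} → Touches P v → ∃[ zs ] PathFrom R v w zs) → halfEdges P (edges vs) ≡ []
  halfEdges-along-path acyc P here _ = refl
  halfEdges-along-path {w = w} acyc P (step {w = w′} r p) reaches
    with walk-head p
  ... | _ , refl with touches? P w ×-dec touches? P w′
  ...   | yes (_ , touched) = ⊥-elim (acyc _ _ _ r (proj₂ (reaches touched)))
  ...   | no _ = halfEdges-along-path acyc (P ++ [ (w , w′) ]) p reaches′
    where
    reaches′ : ∀ {v} → Touches (P ++ [ (w , w′) ]) v → ∃[ zs ] PathFrom _ v w′ zs
    reaches′ t with Any.++⁻ P t
    ... | inj₁ t′                = walk-++ (proj₂ (reaches t′)) (step r here)
    ... | inj₂ (here (inj₁ refl)) = _ , step r here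
    ... | inj₂ (here (inj₂ refl)) = _ , here

  path-determined : Acyclic R → PathFrom R x y vs → Determined (edges vs) []
  path-determined {vs = vs} acyc p =
    subst (Determined (edges vs)) (halfEdges-along-path acyc [] p (λ ()))
      (extend [] [] (edges vs) (Acyclic-mono (walk-edge p) acyc) determined-empty)

  profile : (H : List (Edge n)) → List (Fin n) → Vec Bool (length H)
  profile []      vs = []
  profile (h ∷ H) vs = does (h ∈ᴱ? edges vs) ∷ profile H vs

  profile-SameOn : ∀ H vs ws → profile H vs ≡ profile H ws → SameOn H vs ws
  profile-SameOn (h ∷ H) vs ws eq (here refl) m with h ∈ᴱ? edges vs | h ∈ᴱ? edges ws | eq
  ... | yes _  | yes m′ | _  = m′
  ... | no m∉  | _      | _  = ⊥-elim (m∉ m)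
  ... | yes _  | no _   | ()
  profile-SameOn (h ∷ H) vs ws eq (there h∈H) m =
    profile-SameOn H vs ws (cong tail eq) h∈H m

open Walks

lemma1 : ∀ (n : ℕ) (E : Graph n) → Acyclic E → (s t : Fin n)
    → (π : List (Fin n)) → PathFrom E s t π
    → (es : List (Edge n)) → Unique es
    → All (λ e → E (proj₁ e) (proj₂ e)) es
    → All (λ e → e ∉ edges π) es
    → (ps : List (List (Fin n))) → Unique ps
    → (∀ vs → vs ∈ ps → PathFrom (InA (edges π) es) s t vs)
    → (∀ vs → PathFrom (InA (edges π) es) s t vs → vs ∈ ps)
    → prodMult (edges π) es ≤ recipℕ (length ps)
lemma1 n _ acyc s t π π-path es _ es⊆E _ ps ps-unique sound complete =
  subst (_≤ recipℕ (length ps)) (sym (prodMult-halfEdges γ es))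
    (recipℕ-antimono (∈-length π∈ps) count)
  where
  γ : List (Edge n)
  γ = edges π

  H : List (Edge n)
  H = halfEdges γ es

  a-acyclic : Acyclic (graphOf (γ ++ es))
  a-acyclic = Acyclic-mono (Sum.[ walk-edge π-path , All.lookup es⊆E ] ∘ ∈-++⁻ γ) acyc

  a-determined : Determined (γ ++ es) H
  a-determined = extend γ [] es a-acyclic (path-determined acyc π-path)

  in-a : ∀ {vs} → PathFrom (InA γ es) s t vs → PathFrom (graphOf (γ ++ es)) s t vs
  in-a = walk-map Sum.[ ∈-++⁺ˡ , ∈-++⁺ʳ γ ]

  count : length ps ℕ.≤ 2 ^ length H
  count = injective-into-bits (length H) (profile H) ps ps-unique λ p∈ q∈ eq →
    a-determined (in-a (sound _ p∈)) (in-a (sound _ q∈))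
      (profile-SameOn H _ _ eq) (profile-SameOn H _ _ (sym eq))

  π∈ps : π ∈ ps
  π∈ps = complete π (walk-map inj₁ (walk-in-own-edges π-path))
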